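{- Let $A\subset\mathbb{Z}$ be a $g_1$-difference set for $[N]$ of size $|A|=k$, and let $C\subseteq\mathbb{Z}/q\mathbb{Z}$ be a $g_2$-difference set (in the group $\mathbb{Z}/q\mathbb{Z}$) of size $|C|=\ell$. Then there is a $g_1g_2$-difference set $B\subset\mathbb{Z}$ for $[qN]$ of size $k\ell$.
   Context: Write $[N]=\{1,\ldots,N\}$. For a subset $A$ of an abelian group $G$ let $r_A(x)=|\{(a_1,a_2)\in A\times A: x=a_1-a_2\}|$. $A\subseteq\mathbb{Z}$ is a $g$-difference set for $[N]$ if $r_A(m)\ge g$ for all $m\in[N]$; $C\subseteq\mathbb{Z}/q\mathbb{Z}$ is a $g$-difference set if $r_C(x)\ge g$ for all $x\in\mathbb{Z}/q\mathbb{Z}$. -}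

module Defs where

open import Data.Nat using (ℕ; _≤_; _<_; NonZero)
open import Data.Integer as ℤ using (ℤ; +_; _-_)
open import Data.Integer.DivMod using (_%ℕ_)
open import Data.List using (List; length; filter; cartesianProduct)
open import Data.List.Relation.Unary.All using (All)
open import Data.List.Relation.Unary.Unique.Propositional using (Unique)
open import Data.Product using (_×_; _,_; proj₁; proj₂)
import Data.Integer.Properties as ℤP
import Data.Nat.Properties as ℕP

-- A finite set of integers is a duplicate-free list; its size is its length.

r : List ℤ → ℤ → ℕ
r A x = length (filter (λ p → proj₁ p - proj₂ p ℤP.≟ x) (cartesianProduct A A))

IsDiffSetFor : ℕ → ℕ → List ℤ → Set
IsDiffSetFor g N A = ∀ (m : ℕ) → 1 ≤ m → m ≤ N → g ≤ r A (+ m)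

-- Z/qZ is represented by the residues {0,…,q-1} ⊂ ℕ.
-- r_C(x) in Z/qZ: number of pairs (c₁,c₂) ∈ C × C with c₁ - c₂ ≡ x (mod q)
rMod : (q : ℕ) → .{{NonZero q}} → List ℕ → ℕ → ℕ
rMod q C x = length (filter (λ p → ((+ proj₁ p) - (+ proj₂ p)) %ℕ q ℕP.≟ x)
                            (cartesianProduct C C))

IsSubsetZmod : ℕ → List ℕ → Set
IsSubsetZmod q C = All (_< q) C

IsModDiffSet : (q : ℕ) → .{{NonZero q}} → ℕ → List ℕ → Set
IsModDiffSet q g C = ∀ (x : ℕ) → x < q → g ≤ rMod q C x

-- Take B = {q a + c : a ∈ A, c ∈ C} and fix m ∈ [qN]. Each of the at least g₂ pairs
-- (c₁, c₂) ∈ C² with c₁ - c₂ ≡ m (mod q) gives m = q t + c₁ - c₂ with 0 ≤ t ≤ N, and then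
-- every (a₁, a₂) with a₁ - a₂ = t yields the representation m = (q a₁ + c₁) - (q a₂ + c₂).
-- Hence r_B(m) ≥ g₂ · min_{0≤t≤N} r_A(t) ≥ g₁g₂, where t = 0 uses r_A(0) = |A| ≥ r_A(1).
-- Distinct (a, c) give distinct q a + c because 0 ≤ c < q, so |B| = kℓ.
module Submission where

open import Defs
open import Level using (Level)
open import Data.Nat using (ℕ; zero; suc; _+_; _*_; _≤_; _<_; z≤n; s≤s; NonZero; _%_; _/_)
import Data.Nat.Properties as ℕP
open import Data.Nat.DivMod using (m≡m%n+[m/n]*n; m%n<n)
open import Data.Integer as ℤ using (ℤ; +_; _-_; 0ℤ; -1ℤ)
open import Data.Integer.DivMod using (_%ℕ_; _/ℕ_; a≡a%ℕn+[a/ℕn]*n)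
import Data.Integer.Properties as ℤP
import Data.Integer.Tactic.RingSolver as ℤ-Solver
open import Data.Fin using (Fin; toℕ; fromℕ<)
import Data.Fin.Properties as FinP
open import Data.List using (List; []; _∷_; _++_; map; length; filter; cartesianProduct; cartesianProductWith)
import Data.List.Properties as ListP
open import Data.List.Membership.Propositional using (_∈_)
open import Data.List.Relation.Unary.Any using (here; there)
open import Data.List.Relation.Unary.All as All using (All; []; _∷_)
open import Data.List.Relation.Unary.Unique.Propositional using (Unique; []; _∷_)
import Data.List.Relation.Unary.Unique.Propositional.Properties as UniqueP
open import Data.Product using (Σ; ∃-syntax; _×_; _,_; proj₁; proj₂)
open import Relation.Binary.Definitions using (tri<; tri≈; tri>)
open import Relation.Binary.PropositionalEquality
open import Relation.Nullary using (Dec; yes; no; contradiction)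
open import Relation.Unary using (Pred; Decidable)
open import Function using (_∘_)
open import Algebra.Properties.CommutativeSemigroup ℕP.+-commutativeSemigroup
  using () renaming (interchange to +-interchange)
open import Algebra.Properties.AbelianGroup ℤP.+-0-abelianGroup
  using () renaming (∙-cancelˡ to ℤ-+-cancelˡ; xyx⁻¹≈y to ℤ-x+y-x≡y)

private variable
  a b p : Level
  X Y Z Z′ : Set a

∑ : List X → (X → ℕ) → ℕ
∑ []       f = 0
∑ (x ∷ xs) f = f x + ∑ xs f

infix 5 ∑
syntax ∑ xs (λ x → e) = ∑[ x ∈ xs ] e

∑-++ : ∀ (xs ys : List X) f → ∑ (xs ++ ys) f ≡ ∑ xs f + ∑ ys f
∑-++ []       ys f = refl
∑-++ (x ∷ xs) ys f = trans (cong (_+_ (f x)) (∑-++ xs ys f)) (sym (ℕP.+-assoc (f x) _ _))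

∑-map : ∀ (g : X → Y) xs f → ∑ (map g xs) f ≡ ∑[ x ∈ xs ] f (g x)
∑-map g []       f = refl
∑-map g (x ∷ xs) f = cong (_+_ (f (g x))) (∑-map g xs f)

∑-cartesianProductWith : ∀ (g : X → Y → Z) xs ys f →
  ∑ (cartesianProductWith g xs ys) f ≡ ∑[ x ∈ xs ] ∑[ y ∈ ys ] f (g x y)
∑-cartesianProductWith g []       ys f = refl
∑-cartesianProductWith g (x ∷ xs) ys f = trans (∑-++ (map (g x) ys) _ f)
  (cong₂ _+_ (∑-map (g x) ys f) (∑-cartesianProductWith g xs ys f))

∑-cong : ∀ (xs : List X) {f g} → (∀ x → f x ≡ g x) → ∑ xs f ≡ ∑ xs g
∑-cong []       f≗g = refl
∑-cong (x ∷ xs) f≗g = cong₂ _+_ (f≗g x) (∑-cong xs f≗g)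

∑-mono-∈ : ∀ (xs : List X) {f g} → (∀ {x} → x ∈ xs → f x ≤ g x) → ∑ xs f ≤ ∑ xs g
∑-mono-∈ []       f≤g = z≤n
∑-mono-∈ (x ∷ xs) f≤g = ℕP.+-mono-≤ (f≤g (here refl)) (∑-mono-∈ xs (f≤g ∘ there))

∑-zero : ∀ (xs : List X) → ∑[ x ∈ xs ] 0 ≡ 0
∑-zero []       = refl
∑-zero (x ∷ xs) = ∑-zero xs

∑-one : ∀ (xs : List X) → ∑[ x ∈ xs ] 1 ≡ length xs
∑-one []       = refl
∑-one (x ∷ xs) = cong suc (∑-one xs)

∑-distrib-+ : ∀ (xs : List X) f g → ∑[ x ∈ xs ] (f x + g x) ≡ ∑ xs f + ∑ xs g
∑-distrib-+ []       f g = refl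
∑-distrib-+ (x ∷ xs) f g = begin
  (f x + g x) + (∑[ x ∈ xs ] (f x + g x)) ≡⟨ cong (_+_ (f x + g x)) (∑-distrib-+ xs f g) ⟩
  (f x + g x) + (∑ xs f + ∑ xs g)         ≡⟨ +-interchange (f x) (g x) _ _ ⟩
  (f x + ∑ xs f) + (g x + ∑ xs g)         ∎
  where open ≡-Reasoning

∑-comm : ∀ (xs : List X) (ys : List Y) (h : X → Y → ℕ) →
  ∑[ x ∈ xs ] ∑[ y ∈ ys ] h x y ≡ ∑[ y ∈ ys ] ∑[ x ∈ xs ] h x y
∑-comm []       ys h = sym (∑-zero ys)
∑-comm (x ∷ xs) ys h = trans (cong (_+_ (∑ ys (h x))) (∑-comm xs ys h))
  (sym (∑-distrib-+ ys (h x) (λ y → ∑[ x ∈ xs ] h x y)))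

*-distribˡ-∑ : ∀ k (xs : List X) f → k * ∑ xs f ≡ ∑[ x ∈ xs ] k * f x
*-distribˡ-∑ k []       f = ℕP.*-zeroʳ k
*-distribˡ-∑ k (x ∷ xs) f = trans (ℕP.*-distribˡ-+ k (f x) _) (cong (_+_ (k * f x)) (*-distribˡ-∑ k xs f))

∑²-cartesianProductWith : ∀ (f : X → Y → Z) xs ys (h : Z → Z → ℕ) →
  ∑[ z₁ ∈ cartesianProductWith f xs ys ] ∑[ z₂ ∈ cartesianProductWith f xs ys ] h z₁ z₂
  ≡ ∑[ y₁ ∈ ys ] ∑[ y₂ ∈ ys ] ∑[ x₁ ∈ xs ] ∑[ x₂ ∈ xs ] h (f x₁ y₁) (f x₂ y₂)
∑²-cartesianProductWith f xs ys h = begin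
  ∑[ z₁ ∈ cartesianProductWith f xs ys ] ∑[ z₂ ∈ cartesianProductWith f xs ys ] h z₁ z₂
    ≡⟨ ∑-cartesianProductWith f xs ys _ ⟩
  ∑[ x₁ ∈ xs ] ∑[ y₁ ∈ ys ] ∑[ z₂ ∈ cartesianProductWith f xs ys ] h (f x₁ y₁) z₂
    ≡⟨ ∑-cong xs (λ x₁ → ∑-cong ys (λ y₁ → ∑-cartesianProductWith f xs ys _)) ⟩
  ∑[ x₁ ∈ xs ] ∑[ y₁ ∈ ys ] ∑[ x₂ ∈ xs ] ∑[ y₂ ∈ ys ] h (f x₁ y₁) (f x₂ y₂)
    ≡⟨ ∑-comm xs ys _ ⟩
  ∑[ y₁ ∈ ys ] ∑[ x₁ ∈ xs ] ∑[ x₂ ∈ xs ] ∑[ y₂ ∈ ys ] h (f x₁ y₁) (f x₂ y₂)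
    ≡⟨ ∑-cong ys (λ y₁ → ∑-cong xs (λ x₁ → ∑-comm xs ys _)) ⟩
  ∑[ y₁ ∈ ys ] ∑[ x₁ ∈ xs ] ∑[ y₂ ∈ ys ] ∑[ x₂ ∈ xs ] h (f x₁ y₁) (f x₂ y₂)
    ≡⟨ ∑-cong ys (λ y₁ → ∑-comm xs ys _) ⟩
  ∑[ y₁ ∈ ys ] ∑[ y₂ ∈ ys ] ∑[ x₁ ∈ xs ] ∑[ x₂ ∈ xs ] h (f x₁ y₁) (f x₂ y₂) ∎
  where
  open ≡-Reasoning

length-cartesianProductWith : ∀ (f : X → Y → Z) xs ys →
  length (cartesianProductWith f xs ys) ≡ length xs * length ys
length-cartesianProductWith f []       ys = refl
length-cartesianProductWith f (x ∷ xs) ys = trans (ListP.length-++ (map (f x) ys))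
  (cong₂ _+_ (ListP.length-map (f x) ys) (length-cartesianProductWith f xs ys))

𝟙 : {P : Set p} → Dec P → ℕ
𝟙 (yes _) = 1
𝟙 (no _)  = 0

𝟙-mono : {P : Set p} {Q : Set b} → (P → Q) → (P? : Dec P) (Q? : Dec Q) → 𝟙 P? ≤ 𝟙 Q?
𝟙-mono P⇒Q (yes P) (yes _) = ℕP.≤-refl
𝟙-mono P⇒Q (yes P) (no ¬Q) = contradiction (P⇒Q P) ¬Q
𝟙-mono P⇒Q (no _)  Q?      = z≤n

*-𝟙-≤ : ∀ {P : Set p} {k n} → (P → k ≤ n) → (P? : Dec P) → k * 𝟙 P? ≤ n
*-𝟙-≤ {k = k} P⇒k≤n (yes P) = ℕP.≤-trans (ℕP.≤-reflexive (ℕP.*-identityʳ k)) (P⇒k≤n P)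
*-𝟙-≤ {k = k} P⇒k≤n (no _)  = ℕP.≤-trans (ℕP.≤-reflexive (ℕP.*-zeroʳ k)) z≤n

length-filter-∑ : ∀ {P : Pred X p} (P? : Decidable P) xs →
  length (filter P? xs) ≡ ∑[ x ∈ xs ] 𝟙 (P? x)
length-filter-∑ P? []       = refl
length-filter-∑ P? (x ∷ xs) with P? x
... | yes _ = cong suc (length-filter-∑ P? xs)
... | no _  = length-filter-∑ P? xs

∑-𝟙-≥-1 : ∀ {P : Pred X p} (P? : Decidable P) {xs x} → x ∈ xs → P x → 1 ≤ ∑[ y ∈ xs ] 𝟙 (P? y)
∑-𝟙-≥-1 P? {y ∷ _}  (here refl) Px with P? y
... | yes _ = s≤s z≤n
... | no ¬P = contradiction Px ¬P
∑-𝟙-≥-1 P? {y ∷ xs} (there x∈xs) Px = ℕP.≤-trans (∑-𝟙-≥-1 P? x∈xs Px) (ℕP.m≤n+m _ (𝟙 (P? y)))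

∑-𝟙-≤-1 : ∀ {P : Pred X p} (P? : Decidable P) {xs} → Unique xs →
  (∀ {x y} → P x → P y → x ≡ y) → ∑[ x ∈ xs ] 𝟙 (P? x) ≤ 1
∑-𝟙-≤-1 P? {[]}     []             P-unique = z≤n
∑-𝟙-≤-1 P? {x ∷ xs} (x∉xs ∷ xs!) P-unique with P? x
... | no _  = ∑-𝟙-≤-1 P? xs! P-unique
... | yes Px = ℕP.≤-reflexive (cong suc (begin
  ∑[ y ∈ xs ] 𝟙 (P? y)  ≡⟨ sym (length-filter-∑ P? xs) ⟩
  length (filter P? xs) ≡⟨ cong length (ListP.filter-none P? (All.map (λ x≢y Py → x≢y (P-unique Px Py)) x∉xs)) ⟩
  0                     ∎))
  where open ≡-Reasoning

length-filter-cartesianProduct : ∀ {R : X → Y → Set p} (R? : ∀ x y → Dec (R x y)) xs ys →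
  length (filter (λ xy → R? (proj₁ xy) (proj₂ xy)) (cartesianProduct xs ys))
  ≡ ∑[ x ∈ xs ] ∑[ y ∈ ys ] 𝟙 (R? x y)
length-filter-cartesianProduct R? xs ys =
  trans (length-filter-∑ _ (cartesianProduct xs ys)) (∑-cartesianProductWith _,_ xs ys _)

r-∑ : ∀ A x → r A x ≡ ∑[ a₁ ∈ A ] ∑[ a₂ ∈ A ] 𝟙 (a₁ - a₂ ℤP.≟ x)
r-∑ A x = length-filter-cartesianProduct (λ a₁ a₂ → a₁ - a₂ ℤP.≟ x) A A

rMod-∑ : ∀ q .{{_ : NonZero q}} C x →
  rMod q C x ≡ ∑[ c₁ ∈ C ] ∑[ c₂ ∈ C ] 𝟙 ((+ c₁ - + c₂) %ℕ q ℕP.≟ x)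
rMod-∑ q C x = length-filter-cartesianProduct (λ c₁ c₂ → (+ c₁ - + c₂) %ℕ q ℕP.≟ x) C C

r≤length : ∀ {A} x → Unique A → r A x ≤ length A
r≤length {A} x A! = begin
  r A x                                      ≡⟨ r-∑ A x ⟩
  ∑[ a₁ ∈ A ] ∑[ a₂ ∈ A ] 𝟙 (a₁ - a₂ ℤP.≟ x) ≤⟨ ∑-mono-∈ A (λ {a₁} _ →
                                                  ∑-𝟙-≤-1 (λ a₂ → a₁ - a₂ ℤP.≟ x) A! (subtrahend-unique a₁)) ⟩
  ∑[ a₁ ∈ A ] 1                              ≡⟨ ∑-one A ⟩
  length A                                   ∎
  where
  open ℕP.≤-Reasoning
  subtrahend-unique : ∀ a {b b′} → a - b ≡ x → a - b′ ≡ x → b ≡ b′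
  subtrahend-unique a {b} {b′} a-b≡x a-b′≡x = ℤP.neg-injective (ℤ-+-cancelˡ a _ _ (trans a-b≡x (sym a-b′≡x)))

length≤r0 : ∀ A → length A ≤ r A 0ℤ
length≤r0 A = begin
  length A                                   ≡⟨ sym (∑-one A) ⟩
  ∑[ a₁ ∈ A ] 1                              ≤⟨ ∑-mono-∈ A (λ {a₁} a₁∈A →
                                                  ∑-𝟙-≥-1 (λ a₂ → a₁ - a₂ ℤP.≟ 0ℤ) a₁∈A (ℤP.+-inverseʳ a₁)) ⟩
  ∑[ a₁ ∈ A ] ∑[ a₂ ∈ A ] 𝟙 (a₁ - a₂ ℤP.≟ 0ℤ) ≡⟨ sym (r-∑ A 0ℤ) ⟩
  r A 0ℤ                                     ∎
  where open ℕP.≤-Reasoning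

IsDiffSetFor⇒≤r : ∀ {g N A} → Unique A → IsDiffSetFor g N A → 0 < N → ∀ {t} → t ≤ N → g ≤ r A (+ t)
IsDiffSetFor⇒≤r {A = A} A! A-diff N>0 {zero}  _   =
  ℕP.≤-trans (A-diff 1 ℕP.≤-refl N>0) (ℕP.≤-trans (r≤length (+ 1) A!) (length≤r0 A))
IsDiffSetFor⇒≤r         A! A-diff N>0 {suc t} t≤N = A-diff (suc t) (s≤s z≤n) t≤N

embed : ℕ → ℤ → ℕ → ℤ
embed q a c = + q ℤ.* a ℤ.+ + c

embed-< : ∀ q {a a′ c c′} → a ℤ.< a′ → c < q → embed q a c ℤ.< embed q a′ c′
embed-< q {a} {a′} {c} {c′} a<a′ c<q = begin-strict
  + q ℤ.* a ℤ.+ + c         <⟨ ℤP.+-monoʳ-< (+ q ℤ.* a) (ℤ.+<+ c<q) ⟩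
  + q ℤ.* a ℤ.+ + q         ≡⟨ ℤP.+-comm (+ q ℤ.* a) (+ q) ⟩
  + q ℤ.+ + q ℤ.* a         ≡⟨ sym (ℤP.*-suc (+ q) a) ⟩
  + q ℤ.* ℤ.suc a           ≤⟨ ℤP.*-monoˡ-≤-nonNeg (+ q) (ℤP.i<j⇒suc[i]≤j a<a′) ⟩
  + q ℤ.* a′                ≤⟨ ℤP.i≤i+j (+ q ℤ.* a′) (+ c′) ⟩
  + q ℤ.* a′ ℤ.+ + c′       ∎
  where open ℤP.≤-Reasoning

embed-injective : ∀ q {a a′} {i j : Fin q} → embed q a (toℕ i) ≡ embed q a′ (toℕ j) → a ≡ a′ × i ≡ j
embed-injective q {a} {a′} {i} {j} eq with ℤP.<-cmp a a′
... | tri< a<a′ _ _ = contradiction eq (ℤP.<⇒≢ (embed-< q a<a′ (FinP.toℕ<n i)))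
... | tri> _ _ a>a′ = contradiction (sym eq) (ℤP.<⇒≢ (embed-< q a>a′ (FinP.toℕ<n j)))
... | tri≈ _ refl _ = refl , FinP.toℕ-injective (ℤP.+-injective (ℤ-+-cancelˡ (+ q ℤ.* a) _ _ eq))

quotient-nonNeg : ∀ {q x c} (τ : ℤ) → c < q → + x ≡ + c ℤ.+ τ ℤ.* + q → 0ℤ ℤ.≤ τ
quotient-nonNeg {q} {x} {c} τ c<q x≡c+τq =
  ℤP.i<j⇒suc[i]≤j (ℤP.*-cancelʳ-<-nonNeg { -1ℤ} {τ} (+ q) -q<τq)
  where
  open ℤP.≤-Reasoning
  -q<τq : -1ℤ ℤ.* + q ℤ.< τ ℤ.* + q
  -q<τq = begin-strict
    -1ℤ ℤ.* + q             ≡⟨ ℤP.-1*i≡-i (+ q) ⟩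
    ℤ.- + q                 <⟨ ℤP.neg-mono-< (ℤ.+<+ c<q) ⟩
    ℤ.- + c                 ≤⟨ ℤP.i≤j+i (ℤ.- + c) (+ x) ⟩
    + x - + c               ≡⟨ cong (_- + c) x≡c+τq ⟩
    + c ℤ.+ τ ℤ.* + q - + c ≡⟨ ℤ-x+y-x≡y (+ c) (τ ℤ.* + q) ⟩
    τ ℤ.* + q               ∎

-- Subtracting the division identities d = ρ + β q and m = ρ + α q of d = c₁ - c₂ and m
-- gives m + c₂ = c₁ + (α - β) q, and α - β ≥ 0 because c₁ < q.
congruent-residues-quotient : ∀ q .{{_ : NonZero q}} {c₁ c₂ m} → c₁ < q →
  (+ c₁ - + c₂) %ℕ q ≡ m % q → ∃[ t ] m + c₂ ≡ c₁ + t * q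
congruent-residues-quotient q {c₁} {c₂} {m} c₁<q d%q≡m%q = ∣τ∣ , ℤP.+-injective (begin
  + (m + c₂)                 ≡⟨ ℤP.pos-+ m c₂ ⟩
  + m ℤ.+ + c₂               ≡⟨ m+c₂≡c₁+τq ⟩
  + c₁ ℤ.+ τ ℤ.* + q         ≡⟨ cong (λ σ → + c₁ ℤ.+ σ ℤ.* + q) (sym (ℤP.0≤i⇒+∣i∣≡i τ≥0)) ⟩
  + c₁ ℤ.+ + ∣τ∣ ℤ.* + q     ≡⟨ cong (ℤ._+_ (+ c₁)) (sym (ℤP.pos-* ∣τ∣ q)) ⟩
  + c₁ ℤ.+ + (∣τ∣ * q)       ≡⟨ sym (ℤP.pos-+ c₁ (∣τ∣ * q)) ⟩
  + (c₁ + ∣τ∣ * q)           ∎)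
  where
  open ≡-Reasoning
  d : ℤ
  d = + c₁ - + c₂
  τ : ℤ
  τ = + (m / q) - d /ℕ q
  ∣τ∣ : ℕ
  ∣τ∣ = ℤ.∣ τ ∣

  d-split : d ≡ + (m % q) ℤ.+ d /ℕ q ℤ.* + q
  d-split = trans (a≡a%ℕn+[a/ℕn]*n d q) (cong (λ ρ → + ρ ℤ.+ d /ℕ q ℤ.* + q) d%q≡m%q)

  m-split : + m ≡ + (m % q) ℤ.+ + (m / q) ℤ.* + q
  m-split = begin
    + m                               ≡⟨ cong +_ (m≡m%n+[m/n]*n m q) ⟩
    + (m % q + m / q * q)             ≡⟨ ℤP.pos-+ (m % q) (m / q * q) ⟩
    + (m % q) ℤ.+ + (m / q * q)       ≡⟨ cong (ℤ._+_ (+ (m % q))) (ℤP.pos-* (m / q) q) ⟩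
    + (m % q) ℤ.+ + (m / q) ℤ.* + q   ∎

  regroup : ∀ (ρ α β c Q : ℤ) → ρ ℤ.+ α ℤ.* Q ℤ.+ c ≡ (ρ ℤ.+ β ℤ.* Q) ℤ.+ c ℤ.+ (α - β) ℤ.* Q
  regroup = ℤ-Solver.solve-∀

  sub-add : ∀ (x y : ℤ) → x - y ℤ.+ y ≡ x
  sub-add = ℤ-Solver.solve-∀

  m+c₂≡c₁+τq : + m ℤ.+ + c₂ ≡ + c₁ ℤ.+ τ ℤ.* + q
  m+c₂≡c₁+τq = begin
    + m ℤ.+ + c₂                                           ≡⟨ cong (ℤ._+ + c₂) m-split ⟩
    + (m % q) ℤ.+ + (m / q) ℤ.* + q ℤ.+ + c₂               ≡⟨ regroup (+ (m % q)) (+ (m / q)) (d /ℕ q) (+ c₂) (+ q) ⟩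
    (+ (m % q) ℤ.+ d /ℕ q ℤ.* + q) ℤ.+ + c₂ ℤ.+ τ ℤ.* + q  ≡⟨ cong (λ e → e ℤ.+ + c₂ ℤ.+ τ ℤ.* + q) (sym d-split) ⟩
    d ℤ.+ + c₂ ℤ.+ τ ℤ.* + q                               ≡⟨ cong (ℤ._+ τ ℤ.* + q) (sub-add (+ c₁) (+ c₂)) ⟩
    + c₁ ℤ.+ τ ℤ.* + q                                     ∎

  τ≥0 : 0ℤ ℤ.≤ τ
  τ≥0 = quotient-nonNeg τ c₁<q (trans (sym (ℤP.pos-+ m c₂)) m+c₂≡c₁+τq)

quotient-≤ : ∀ {q N m c₁ c₂ t} → c₂ < q → m ≤ q * N → m + c₂ ≡ c₁ + t * q → t ≤ N
quotient-≤ {q} {N} {m} {c₁} {c₂} {t} c₂<q m≤qN m+c₂≡c₁+tq =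
  ℕP.≤-pred (ℕP.*-cancelʳ-< q t (suc N) (begin-strict
    t * q            ≤⟨ ℕP.m≤n+m (t * q) c₁ ⟩
    c₁ + t * q       ≡⟨ sym m+c₂≡c₁+tq ⟩
    m + c₂           <⟨ ℕP.+-monoʳ-< m c₂<q ⟩
    m + q            ≤⟨ ℕP.+-monoˡ-≤ q m≤qN ⟩
    q * N + q        ≡⟨ ℕP.+-comm (q * N) q ⟩
    q + q * N        ≡⟨ cong (_+_ q) (ℕP.*-comm q N) ⟩
    suc N * q        ∎))
  where open ℕP.≤-Reasoning

embed-difference : ∀ {q m c₁ c₂ t a₁ a₂} → m + c₂ ≡ c₁ + t * q → a₁ - a₂ ≡ + t →
  embed q a₁ c₁ - embed q a₂ c₂ ≡ + m
embed-difference {q} {m} {c₁} {c₂} {t} {a₁} {a₂} m+c₂≡c₁+tq a₁-a₂≡t = begin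
  embed q a₁ c₁ - embed q a₂ c₂         ≡⟨ regroup (+ q) a₁ a₂ (+ c₁) (+ c₂) ⟩
  + c₁ ℤ.+ (a₁ - a₂) ℤ.* + q - + c₂     ≡⟨ cong (λ δ → + c₁ ℤ.+ δ ℤ.* + q - + c₂) a₁-a₂≡t ⟩
  + c₁ ℤ.+ + t ℤ.* + q - + c₂           ≡⟨ cong (_- + c₂) (sym m+c₂≡c₁+tq′) ⟩
  + m ℤ.+ + c₂ - + c₂                   ≡⟨ add-sub (+ m) (+ c₂) ⟩
  + m                                   ∎
  where
  open ≡-Reasoning
  regroup : ∀ (Q x₁ x₂ y₁ y₂ : ℤ) → (Q ℤ.* x₁ ℤ.+ y₁) - (Q ℤ.* x₂ ℤ.+ y₂) ≡ y₁ ℤ.+ (x₁ - x₂) ℤ.* Q - y₂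
  regroup = ℤ-Solver.solve-∀

  add-sub : ∀ (x y : ℤ) → x ℤ.+ y - y ≡ x
  add-sub = ℤ-Solver.solve-∀

  m+c₂≡c₁+tq′ : + m ℤ.+ + c₂ ≡ + c₁ ℤ.+ + t ℤ.* + q
  m+c₂≡c₁+tq′ = begin
    + m ℤ.+ + c₂          ≡⟨ sym (ℤP.pos-+ m c₂) ⟩
    + (m + c₂)            ≡⟨ cong +_ m+c₂≡c₁+tq ⟩
    + (c₁ + t * q)        ≡⟨ ℤP.pos-+ c₁ (t * q) ⟩
    + c₁ ℤ.+ + (t * q)    ≡⟨ cong (ℤ._+_ (+ c₁)) (ℤP.pos-* t q) ⟩
    + c₁ ℤ.+ + t ℤ.* + q  ∎

m*n>0⇒n>0 : ∀ m {n} → 0 < m * n → 0 < n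
m*n>0⇒n>0 m {zero}  m*0>0 = contradiction (ℕP.*-zeroʳ m) (ℕP.>⇒≢ m*0>0)
m*n>0⇒n>0 m {suc n} _     = s≤s z≤n

congruent-residues-count : ∀ q .{{_ : NonZero q}} {g N A} → Unique A → IsDiffSetFor g N A → 0 < N →
  ∀ {m c₁ c₂} → m ≤ q * N → c₁ < q → c₂ < q →
  g * 𝟙 ((+ c₁ - + c₂) %ℕ q ℕP.≟ m % q)
  ≤ ∑[ a₁ ∈ A ] ∑[ a₂ ∈ A ] 𝟙 (embed q a₁ c₁ - embed q a₂ c₂ ℤP.≟ + m)
congruent-residues-count q {g} {N} {A} A! A-diff N>0 {m} {c₁} {c₂} m≤qN c₁<q c₂<q =
  *-𝟙-≤ bound ((+ c₁ - + c₂) %ℕ q ℕP.≟ m % q)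
  where
  open ℕP.≤-Reasoning
  bound : (+ c₁ - + c₂) %ℕ q ≡ m % q → g ≤ ∑[ a₁ ∈ A ] ∑[ a₂ ∈ A ] 𝟙 (embed q a₁ c₁ - embed q a₂ c₂ ℤP.≟ + m)
  bound congruent with congruent-residues-quotient q c₁<q congruent
  ... | t , m+c₂≡c₁+tq = begin
    g                                           ≤⟨ IsDiffSetFor⇒≤r A! A-diff N>0 (quotient-≤ c₂<q m≤qN m+c₂≡c₁+tq) ⟩
    r A (+ t)                                   ≡⟨ r-∑ A (+ t) ⟩
    ∑[ a₁ ∈ A ] ∑[ a₂ ∈ A ] 𝟙 (a₁ - a₂ ℤP.≟ + t) ≤⟨ ∑-mono-∈ A (λ {a₁} _ → ∑-mono-∈ A (λ {a₂} _ →
                                                     𝟙-mono (embed-difference m+c₂≡c₁+tq) (a₁ - a₂ ℤP.≟ + t) _)) ⟩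
    ∑[ a₁ ∈ A ] ∑[ a₂ ∈ A ] 𝟙 (embed q a₁ c₁ - embed q a₂ c₂ ℤP.≟ + m) ∎

embed-isDiffSet : ∀ q .{{_ : NonZero q}} {g₁ g₂ N A C} → Unique A → IsDiffSetFor g₁ N A →
  IsSubsetZmod q C → IsModDiffSet q g₂ C → IsDiffSetFor (g₁ * g₂) (q * N) (cartesianProductWith (embed q) A C)
embed-isDiffSet q {g₁} {g₂} {N} {A} {C} A! A-diff C<q C-diff m 1≤m m≤qN = begin
  g₁ * g₂
    ≤⟨ ℕP.*-monoʳ-≤ g₁ (C-diff (m % q) (m%n<n m q)) ⟩
  g₁ * rMod q C (m % q)
    ≡⟨ cong (g₁ *_) (rMod-∑ q C (m % q)) ⟩
  g₁ * (∑[ c₁ ∈ C ] ∑[ c₂ ∈ C ] Congruent c₁ c₂)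
    ≡⟨ trans (*-distribˡ-∑ g₁ C _) (∑-cong C (λ c₁ → *-distribˡ-∑ g₁ C _)) ⟩
  ∑[ c₁ ∈ C ] ∑[ c₂ ∈ C ] g₁ * Congruent c₁ c₂
    ≤⟨ ∑-mono-∈ C (λ c₁∈C → ∑-mono-∈ C (λ c₂∈C →
         congruent-residues-count q A! A-diff N>0 m≤qN (All.lookup C<q c₁∈C) (All.lookup C<q c₂∈C))) ⟩
  ∑[ c₁ ∈ C ] ∑[ c₂ ∈ C ] ∑[ a₁ ∈ A ] ∑[ a₂ ∈ A ] 𝟙 (embed q a₁ c₁ - embed q a₂ c₂ ℤP.≟ + m)
    ≡⟨ sym (∑²-cartesianProductWith (embed q) A C _) ⟩
  ∑[ b₁ ∈ B ] ∑[ b₂ ∈ B ] 𝟙 (b₁ - b₂ ℤP.≟ + m)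
    ≡⟨ sym (r-∑ B (+ m)) ⟩
  r B (+ m) ∎
  where
  open ℕP.≤-Reasoning
  B : List ℤ
  B = cartesianProductWith (embed q) A C
  Congruent : ℕ → ℕ → ℕ
  Congruent c₁ c₂ = 𝟙 ((+ c₁ - + c₂) %ℕ q ℕP.≟ m % q)
  N>0 : 0 < N
  N>0 = m*n>0⇒n>0 q (ℕP.≤-trans 1≤m m≤qN)

toFin : ∀ {q} {C : List ℕ} → All (_< q) C → List (Fin q)
toFin []           = []
toFin (c<q ∷ C<q) = fromℕ< c<q ∷ toFin C<q

map-toℕ-toFin : ∀ {q} {C : List ℕ} (C<q : All (_< q) C) → map toℕ (toFin C<q) ≡ C
map-toℕ-toFin []           = refl
map-toℕ-toFin (c<q ∷ C<q) = cong₂ _∷_ (FinP.toℕ-fromℕ< c<q) (map-toℕ-toFin C<q)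

cartesianProductWith-mapʳ : ∀ (f : X → Y → Z) (g : Z′ → Y) xs ys →
  cartesianProductWith f xs (map g ys) ≡ cartesianProductWith (λ x y → f x (g y)) xs ys
cartesianProductWith-mapʳ f g []       ys = refl
cartesianProductWith-mapʳ f g (x ∷ xs) ys = cong₂ _++_ (sym (ListP.map-∘ ys)) (cartesianProductWith-mapʳ f g xs ys)

-- embed is injective only on residues c < q, hence the detour through Fin q.
embed-unique : ∀ q {A C} → Unique A → IsSubsetZmod q C → Unique C → Unique (cartesianProductWith (embed q) A C)
embed-unique q {A} {C} A! C<q C! = subst Unique B′≡B
  (UniqueP.cartesianProductWith⁺ (λ a i → embed q a (toℕ i)) (embed-injective q) A! C′!)
  where
  C′! : Unique (toFin C<q)
  C′! = UniqueP.map⁻ (subst Unique (sym (map-toℕ-toFin C<q)) C!)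
  B′≡B : cartesianProductWith (λ a i → embed q a (toℕ i)) A (toFin C<q) ≡ cartesianProductWith (embed q) A C
  B′≡B = trans (sym (cartesianProductWith-mapʳ (embed q) toℕ A (toFin C<q)))
               (cong (cartesianProductWith (embed q) A) (map-toℕ-toFin C<q))

mainTheorem10 : (N q g₁ g₂ : ℕ) → .{{_ : NonZero q}} →
    (A : List ℤ) → (C : List ℕ) →
    Unique A → IsDiffSetFor g₁ N A →
    IsSubsetZmod q C → Unique C → IsModDiffSet q g₂ C →
    Σ (List ℤ) (λ B → Unique B × length B ≡ length A * length C
                      × IsDiffSetFor (g₁ * g₂) (q * N) B)
mainTheorem10 N q g₁ g₂ A C A! A-diff C<q C! C-diff =
  cartesianProductWith (embed q) A C ,
  embed-unique q A! C<q C! ,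
  length-cartesianProductWith (embed q) A C ,
  embed-isDiffSet q A! A-diff C<q C-diff
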